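{- Let $B\colon\mathsf{Set}\to\mathsf{Set}$ be a polynomial functor with final coalgebra $(B_\omega,\zeta)$, and let $t_\zeta$ be the companion of the monotone function $b_\zeta$ on $\mathrm{Rel}_{B_\omega}$. For every functor $F\colon\mathsf{Set}\to\mathsf{Set}$ and every causal algebra $\alpha\colon FB_\omega\to B_\omega$, we have $\mathsf{ctx}_\alpha\le t_\zeta$ (pointwise).
   Context: $B$ polynomial: isomorphic to $X\mapsto\coprod_{a\in I}X^{E_a}$. Final sequence: $B_0=1$, $B_{i+1}=BB_i$, $B_j=\lim_{i<j}B_i$ at limit $j$, connecting maps $B_{j,i}$; $B_\omega$ carries the final coalgebra. $\alpha$ is causal if for every set $X$, all $f,g\colon X\to B_\omega$ and $i<\omega$, $B_{\omega,i}\circ f=B_{\omega,i}\circ g$ implies $B_{\omega,i}\circ\alpha\circ Ff=B_{\omega,i}\circ\alpha\circ Fg$. $\mathrm{Rel}_X=\mathcal{P}(X\times X)$ ordered by inclusion. Relation lifting of a functor $H$: for $R\subseteq X\times X$ with projections $\pi_1,\pi_2$, $\mathrm{Rel}(H)(R)=\{(H\pi_1(z),H\pi_2(z))\mid z\in HR\}$. For a coalgebra $f\colon X\to BX$, $b_f(R)=\{(x,y)\mid(f(x),f(y))\in\mathrm{Rel}(B)(R)\}$. For an algebra $\alpha\colon FX\to X$, $\mathsf{ctx}_\alpha(R)=\{(\alpha(u),\alpha(v))\mid(u,v)\in\mathrm{Rel}(F)(R)\}$. The companion of a monotone $b$ on a complete lattice is the greatest monotone $t$ with $t\circ b\le b\circ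 t$. -}

module Defs where

open import Level using (Level; 0ℓ; _⊔_) renaming (suc to lsuc)
open import Data.Nat using (ℕ; zero; suc)
open import Data.Unit using (⊤; tt)
open import Data.Product using (Σ; Σ-syntax; _×_; _,_; proj₁; proj₂)
open import Function using (_∘_; id)
open import Relation.Binary.PropositionalEquality
  using (_≡_; refl; sym; trans; cong; subst)

record SetFunctor : Set₁ where
  field
    F₀    : Set → Set
    F₁    : {X Y : Set} → (X → Y) → F₀ X → F₀ Y
    F-id  : {X : Set} (u : F₀ X) → F₁ id u ≡ u
    F-∘   : {X Y Z : Set} (g : Y → Z) (f : X → Y) (u : F₀ X) →
            F₁ (g ∘ f) u ≡ F₁ g (F₁ f u)

Rel : (ℓ : Level) → Set → Set (lsuc ℓ)
Rel ℓ X = X → X → Set ℓ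

_⊆_ : {ℓ ℓ' : Level} {X : Set} → Rel ℓ X → Rel ℓ' X → Set (ℓ ⊔ ℓ')
R ⊆ S = ∀ x y → R x y → S x y

Graph : {ℓ : Level} {X : Set} → Rel ℓ X → Set ℓ
Graph {X = X} R = Σ[ p ∈ X × X ] R (proj₁ p) (proj₂ p)

_≤ᶠ_ : {X : Set} → (Rel 0ℓ X → Rel 0ℓ X) → (Rel 0ℓ X → Rel 0ℓ X) → Set₁
f ≤ᶠ g = ∀ R → f R ⊆ g R

Monotone : {X : Set} → (Rel 0ℓ X → Rel 0ℓ X) → Set₁
Monotone f = ∀ R S → R ⊆ S → f R ⊆ f S

-- The companion of a monotone b: the greatest monotone t with
-- t ∘ b ≤ b ∘ t, i.e. the join of all such monotone functions.
-- (The join quantifies over all maps Rel_X → Rel_X, so it lands one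
-- universe higher.)
companion : {X : Set} → (Rel 0ℓ X → Rel 0ℓ X) → Rel 0ℓ X → Rel (lsuc 0ℓ) X
companion b R x y =
  Σ[ f ∈ (Rel 0ℓ _ → Rel 0ℓ _) ] (Monotone f × ((f ∘ b) ≤ᶠ (b ∘ f)) × f R x y)

RelF : (F : SetFunctor) {X : Set} → Rel 0ℓ X → Rel 0ℓ (SetFunctor.F₀ F X)
RelF F R u v =
  Σ[ z ∈ F₀ (Graph R) ] (F₁ (proj₁ ∘ proj₁) z ≡ u × F₁ (proj₂ ∘ proj₁) z ≡ v)
  where open SetFunctor F

ctx : (F : SetFunctor) {X : Set} → (SetFunctor.F₀ F X → X) → Rel 0ℓ X → Rel 0ℓ X
ctx F {X} α R x y = Σ[ u ∈ F₀ X ] Σ[ v ∈ F₀ X ] (RelF F R u v × α u ≡ x × α v ≡ y)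
  where open SetFunctor F

module Polynomial (I : Set) (E : I → Set) where

  B₀ : Set → Set
  B₀ X = Σ[ a ∈ I ] (E a → X)

  B₁ : {X Y : Set} → (X → Y) → B₀ X → B₀ Y
  B₁ f x = proj₁ x , f ∘ proj₂ x

  B : SetFunctor
  B = record { F₀ = B₀ ; F₁ = B₁ ; F-id = λ _ → refl ; F-∘ = λ _ _ _ → refl }

  Bn : ℕ → Set
  Bn zero    = ⊤
  Bn (suc i) = B₀ (Bn i)

  p : (i : ℕ) → Bn (suc i) → Bn i
  p zero    _ = tt
  p (suc i)   = B₁ (p i)

  -- B_ω = lim_{i<ω} B_i  (compatible sequences)
  Bω : Set
  Bω = Σ[ s ∈ ((i : ℕ) → Bn i) ] ((i : ℕ) → p i (s (suc i)) ≡ s i)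

  πω : (i : ℕ) → Bω → Bn i
  πω i x = proj₁ x i

  -- the final coalgebra structure ζ : B_ω → B B_ω
  -- (inverse of the canonical map B B_ω → B_ω)
  private
    shape : Bω → I
    shape x = proj₁ (proj₁ x 1)

    shape-eq : (x : Bω) (i : ℕ) → proj₁ (proj₁ x (suc i)) ≡ shape x
    shape-eq x zero    = refl
    shape-eq x (suc i) = trans (cong proj₁ (proj₂ x (suc i))) (shape-eq x i)

    child : (x : Bω) → E (shape x) → (i : ℕ) → Bn i
    child x e i = proj₂ (proj₁ x (suc i)) (subst E (sym (shape-eq x i)) e)

    lem : {X : Set} {u v : B₀ X} (q : u ≡ v) {a₀ : I} (eq : proj₁ v ≡ a₀)
          (e : E a₀) →
          proj₂ u (subst E (sym (trans (cong proj₁ q) eq)) e)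
            ≡ proj₂ v (subst E (sym eq) e)
    lem refl eq e = refl

  ζ : Bω → B₀ Bω
  ζ x = shape x , λ e → child x e , λ i → lem (proj₂ x (suc i)) (shape-eq x i) e

  Causal : (F : SetFunctor) → (SetFunctor.F₀ F Bω → Bω) → Set₁
  Causal F α =
    (X : Set) (f g : X → Bω) (i : ℕ) →
    ((x : X) → πω i (f x) ≡ πω i (g x)) →
    (u : F₀ X) → πω i (α (F₁ f u)) ≡ πω i (α (F₁ g u))
    where open SetFunctor F

  bζ : Rel 0ℓ Bω → Rel 0ℓ Bω
  bζ R x y = RelF B R (ζ x) (ζ y)

-- Write x ~ᵢ y when two elements of the final coalgebra B_ω agree up to
-- depth i, i.e. πᵢ x ≡ πᵢ y.  For a relation R let depthClosure R be the
-- intersection of all the ~ᵢ that contain R.  The proof shows: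
--   (1) depthClosure is monotone and b_ζ-compatible, because b_ζ moves
--       "R ⊆ ~ᵢ" to "b_ζ R ⊆ ~ᵢ₊₁" and, conversely, agreement of x and y at
--       every depth i+1 splits into equal shapes of ζ x, ζ y and agreement of
--       their children at depth i;
--   (2) hence depthClosure lies below the companion t_ζ, which is the join
--       of all monotone compatible functions;
--   (3) causality of α says exactly that ctx_α maps relations below ~ᵢ to
--       relations below ~ᵢ, so ctx_α R ⊆ depthClosure R.
-- The theorem is (3) followed by (2).  Function extensionality is used
-- only to compare the children maps of elements of the polynomial functor.

module Submission where

open import Defs
open import Level using (0ℓ)
open import Axiom.Extensionality.Propositional using (Extensionality)
open import Data.Nat using (ℕ; suc)
open import Data.Product using (_,_; proj₁; proj₂)
open import Function using (_∘_)
open import Relation.Binary.PropositionalEquality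
  using (_≡_; refl; sym; trans; cong; subst)
open Relation.Binary.PropositionalEquality.≡-Reasoning

compatible⇒≤companion : {X : Set} (b f : Rel 0ℓ X → Rel 0ℓ X) →
  Monotone f → (f ∘ b) ≤ᶠ (b ∘ f) → ∀ R → f R ⊆ companion b R
compatible⇒≤companion b f f-mono f-compat R x y fRxy = f , f-mono , f-compat , fRxy

Ker : {X Y : Set} → (X → Y) → Rel 0ℓ X
Ker f x y = f x ≡ f y

module _ (ext : Extensionality 0ℓ 0ℓ) (I : Set) (E : I → Set) where
  open Polynomial I E

  RelB-Ker : {X Y : Set} (f : X → Y) (R : Rel 0ℓ X) → R ⊆ Ker f →
             RelF B R ⊆ Ker (B₁ f)
  RelB-Ker f R R⊆Ker _ _ (z , refl , refl) =
    cong (proj₁ z ,_) (ext λ e → R⊆Ker _ _ (proj₂ (proj₂ z e)))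

  RelB-intro : {X : Set} (S : Rel 0ℓ X) (u v : B₀ X) (q : proj₁ u ≡ proj₁ v) →
               (∀ e → S (proj₂ u e) (proj₂ v (subst E q e))) → RelF B S u v
  RelB-intro S (a , h) (.a , h') refl children =
    (a , λ e → (h e , h' e) , children e) , refl , refl

  children-≡ : {X : Set} {a a' : I} {h : E a → X} {h' : E a' → X} →
               _≡_ {A = B₀ X} (a , h) (a' , h') →
               (q : a ≡ a') → ∀ e → h e ≡ h' (subst E q e)
  children-≡ refl refl e = refl

  stage : (x : Bω) (i : ℕ) → πω (suc i) x ≡ B₁ (πω i) (ζ x)
  stage x i = expand (proj₁ x (suc i)) _
    where
    expand : {X : Set} (u : B₀ X) {a : I} (q : proj₁ u ≡ a) →
             u ≡ (a , λ e → proj₂ u (subst E (sym q) e))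
    expand u refl = refl

  Depth : ℕ → Rel 0ℓ Bω
  Depth i = Ker (πω i)

  depthClosure : Rel 0ℓ Bω → Rel 0ℓ Bω
  depthClosure R x y = ∀ i → R ⊆ Depth i → Depth i x y

  depthClosure-mono : Monotone depthClosure
  depthClosure-mono R S R⊆S x y closed i S⊆~ =
    closed i (λ a b Rab → S⊆~ a b (R⊆S a b Rab))

  bζ-step : (R : Rel 0ℓ Bω) (i : ℕ) → R ⊆ Depth i → bζ R ⊆ Depth (suc i)
  bζ-step R i R⊆~ x y bζRxy = begin
    πω (suc i) x        ≡⟨ stage x i ⟩
    B₁ (πω i) (ζ x)     ≡⟨ RelB-Ker (πω i) R R⊆~ (ζ x) (ζ y) bζRxy ⟩
    B₁ (πω i) (ζ y)     ≡⟨ sym (stage y i) ⟩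
    πω (suc i) y        ∎

  -- depthClosure ∘ b_ζ ≤ b_ζ ∘ depthClosure: if x, y agree at every depth
  -- forced by b_ζ R, then ζ x, ζ y have the same shape and children that
  -- agree at every depth forced by R.
  depthClosure-compatible : (depthClosure ∘ bζ) ≤ᶠ (bζ ∘ depthClosure)
  depthClosure-compatible R x y closed =
    RelB-intro (depthClosure R) (ζ x) (ζ y) sameShape childrenClosed
    where
    agree : ∀ i → R ⊆ Depth i → B₁ (πω i) (ζ x) ≡ B₁ (πω i) (ζ y)
    agree i R⊆~ = begin
      B₁ (πω i) (ζ x)   ≡⟨ sym (stage x i) ⟩
      πω (suc i) x      ≡⟨ closed (suc i) (bζ-step R i R⊆~) ⟩
      πω (suc i) y      ≡⟨ stage y i ⟩
      B₁ (πω i) (ζ y)   ∎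

    sameShape : proj₁ (ζ x) ≡ proj₁ (ζ y)
    sameShape = cong proj₁ (agree 0 (λ _ _ _ → refl))

    childrenClosed : ∀ e → depthClosure R (proj₂ (ζ x) e)
                                          (proj₂ (ζ y) (subst E sameShape e))
    childrenClosed e i R⊆~ = children-≡ (agree i R⊆~) sameShape e

  ctx-causal : (F : SetFunctor) (α : SetFunctor.F₀ F Bω → Bω) → Causal F α →
               (R : Rel 0ℓ Bω) (i : ℕ) → R ⊆ Depth i → ctx F α R ⊆ Depth i
  ctx-causal F α causal R i R⊆~ x y (_ , _ , (z , refl , refl) , refl , refl) =
    causal (Graph R) (proj₁ ∘ proj₁) (proj₂ ∘ proj₁) i
           (λ w → R⊆~ _ _ (proj₂ w)) z

  ctx≤depthClosure : (F : SetFunctor) (α : SetFunctor.F₀ F Bω → Bω) →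
                     Causal F α → ∀ R → ctx F α R ⊆ depthClosure R
  ctx≤depthClosure F α causal R x y ctxRxy i R⊆~ =
    ctx-causal F α causal R i R⊆~ x y ctxRxy

theorem9p10 : Extensionality 0ℓ 0ℓ →
    (I : Set) (E : I → Set) →
    let open Polynomial I E in
    (F : SetFunctor) (α : SetFunctor.F₀ F Bω → Bω) → Causal F α →
    (R : Rel 0ℓ Bω) → ctx F α R ⊆ companion bζ R
theorem9p10 ext I E F α causal R x y ctxRxy =
  compatible⇒≤companion bζ (depthClosure ext I E)
    (depthClosure-mono ext I E) (depthClosure-compatible ext I E)
    R x y (ctx≤depthClosure ext I E F α causal R x y ctxRxy)
  where open Polynomial I E using (bζ)
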